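{- Let $K$ be a field and $q\in K^\times$ with $q^N\neq1$ for all integers $N\geq1$. Let $0\leq h\leq k$, $a_0,a_{k+1}\in K^\times$, $a_1,\dots,a_k\in K$, and assume all the iterated $q$-integral symbols below are defined. Then \begin{align*} &I_q(a_0;a_1,\dots,a_h,0,a_{h+1},\dots,a_k;a_{k+1})-I_q(a_0;a_1,\dots,a_h,0,a_{h+1}q,\dots,a_kq;a_{k+1}q)\\ &=I_q(a_0;a_1,\dots,a_h,a_{h+1},\dots,a_k;a_{k+1}). \end{align*}
   Context: Define a partial order on $K^\times$ by $x\trianglelefteq y$ iff $y/x\in\{q^{ -n}\mid n\in\mathbb{Z}_{\geq0}\}$. For $x,y\in K^\times$ with $x\trianglelefteq y$ and $u_1,\dots,u_m\in K$ such that no $t$ with $x\trianglelefteq t\trianglelefteq y$ equals any $u_j$, set \[ I_q(x;u_1,\dots,u_m;y):=\sum_{x\trianglelefteq t_1\trianglelefteq\cdots\trianglelefteq t_m\trianglelefteq y}\prod_{j=1}^m\frac{t_j}{t_j-u_j} \] (equal to $1$ when $m=0$); in particular a factor with $u_j=0$ equals $1$. -}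

module Defs where

open import Level using (Level; _⊔_)
open import Data.Nat using (ℕ; zero; suc)
open import Data.Product using (Σ; _×_; proj₁)
open import Data.List using (List; []; _∷_)
open import Data.List.Relation.Unary.All using (All)
open import Relation.Nullary using (¬_)
open import Algebra.Bundles using (CommutativeRing)

-- A field: a commutative ring with 0 ≠ 1 and a (total) inverse map that is a
-- genuine inverse on nonzero elements (the value 0⁻¹ is irrelevant).
record Field (c ℓ : Level) : Set (Level.suc (c ⊔ ℓ)) where
  field
    commutativeRing : CommutativeRing c ℓ
  open CommutativeRing commutativeRing public
  field
    _⁻¹        : Carrier → Carrier
    ⁻¹-cong    : ∀ {x y} → x ≈ y → x ⁻¹ ≈ y ⁻¹
    0≉1        : ¬ (0# ≈ 1#)
    inverseʳ   : ∀ x → ¬ (x ≈ 0#) → x * (x ⁻¹) ≈ 1#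

  _/_ : Carrier → Carrier → Carrier
  x / y = x * (y ⁻¹)

  _^_ : Carrier → ℕ → Carrier
  x ^ zero  = 1#
  x ^ suc n = x * (x ^ n)

module QIntegral {c ℓ : Level} (F : Field c ℓ) (q : Field.Carrier F) where
  open Field F hiding (zero)

  -- x ⊴ y  iff  y/x ∈ {q^{-n} | n ≥ 0}, i.e. (x,y nonzero) x = y·q^n for some n ≥ 0.
  _⊴_ : Carrier → Carrier → Set ℓ
  x ⊴ y = Σ ℕ (λ n → x ≈ y * (q ^ n))

  sumTo : ℕ → (ℕ → Carrier) → Carrier
  sumTo zero    f = f zero
  sumTo (suc N) f = sumTo N f + f (suc N)

  -- Chains x ⊴ t₁ ⊴ ⋯ ⊴ tₘ ⊴ y with x = y·q^N are exactly tⱼ = y·q^{nⱼ},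
  -- N ≥ n₁ ≥ n₂ ≥ ⋯ ≥ nₘ ≥ 0.  chainSum y B us sums ∏ tⱼ/(tⱼ - uⱼ)
  -- over such chains with n₁ ≤ B.
  chainSum : Carrier → ℕ → List Carrier → Carrier
  chainSum y B []       = 1#
  chainSum y B (u ∷ us) =
    sumTo B (λ n → ((y * (q ^ n)) / ((y * (q ^ n)) - u)) * chainSum y n us)

  Iq : (x : Carrier) → List Carrier → (y : Carrier) → x ⊴ y → Carrier
  Iq x us y p = chainSum y (proj₁ p) us

  IqDefined : Carrier → List Carrier → Carrier → Set (c ⊔ ℓ)
  IqDefined x us y = (x ⊴ y) × (∀ t → x ⊴ t → t ⊴ y → All (λ u → t ≉ u) us)

{-# OPTIONS --safe #-}
-- Write a₀ = aₖ₊₁ q^(M+1). A chain in I_q(a₀; u₁,…,uₘ; aₖ₊₁) is a sequence of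
-- exponents M+1 ≥ n₁ ≥ ⋯ ≥ nₘ ≥ 0 with tⱼ = aₖ₊₁ q^nⱼ, and a letter 0 contributes
-- the factor 1, so the first symbol sums over chains with a free index n in
-- between n_h and n_(h+1). Replacing aₖ₊₁ by aₖ₊₁ q shifts the exponents of the
-- first h letters by one, while scaling a letter and the endpoint by q together
-- leaves its factor unchanged. Hence the second symbol is exactly the part of
-- the first one where n < n_h (with n₀ = M+1), and the remaining part n = n_h is
-- the right-hand side.
module Submission where

open import Defs
open import Level using (Level; _⊔_)
open import Data.Nat as ℕ using (ℕ; zero; suc; _≤_; _∸_)
open import Data.Nat.Properties using (≤-refl; ≤-trans; m≤n⇒m≤1+n; m+[n∸m]≡n)
open import Data.Product using (proj₁; _,_)
open import Data.List using (List; []; _∷_; _++_; map)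
open import Data.List.Relation.Unary.All as All using (All)
open import Data.List.Relation.Unary.All.Properties using (++⁻ʳ)
open import Relation.Nullary using (contradiction)
open import Relation.Binary.PropositionalEquality as ≡ using (_≡_)
import Relation.Binary.Reasoning.Setoid as SetoidReasoning
import Algebra.Properties.CommutativeSemigroup as CommutativeSemigroupProperties
import Algebra.Properties.AbelianGroup as AbelianGroupProperties
import Algebra.Properties.Ring as RingProperties

module FieldProperties {c ℓ : Level} (F : Field c ℓ) where
  open Field F hiding (zero)
  open SetoidReasoning setoid
  open CommutativeSemigroupProperties *-commutativeSemigroup using (xy∙z≈x∙zy)
  open AbelianGroupProperties +-abelianGroup using (x∙y⁻¹≈ε⇒x≈y)

  /-cong : ∀ {x x′ y y′} → x ≈ x′ → y ≈ y′ → x / y ≈ x′ / y′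
  /-cong x≈x′ y≈y′ = *-cong x≈x′ (⁻¹-cong y≈y′)

  x/y*y≈x : ∀ x {y} → y ≉ 0# → (x / y) * y ≈ x
  x/y*y≈x x {y} y≉0 = begin
    (x * y ⁻¹) * y  ≈⟨ xy∙z≈x∙zy x (y ⁻¹) y ⟩
    x * (y * y ⁻¹)  ≈⟨ *-congˡ (inverseʳ y y≉0) ⟩
    x * 1#          ≈⟨ *-identityʳ x ⟩
    x               ∎

  x*y/y≈x : ∀ x {y} → y ≉ 0# → (x * y) / y ≈ x
  x*y/y≈x x {y} y≉0 = begin
    (x * y) * y ⁻¹  ≈⟨ *-assoc x y (y ⁻¹) ⟩
    x * (y * y ⁻¹)  ≈⟨ *-congˡ (inverseʳ y y≉0) ⟩
    x * 1#          ≈⟨ *-identityʳ x ⟩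
    x               ∎

  *-cancelʳ : ∀ {z x y} → z ≉ 0# → x * z ≈ y * z → x ≈ y
  *-cancelʳ {z} {x} {y} z≉0 xz≈yz = begin
    x               ≈⟨ x*y/y≈x x z≉0 ⟨
    (x * z) / z     ≈⟨ /-cong xz≈yz refl ⟩
    (y * z) / z     ≈⟨ x*y/y≈x y z≉0 ⟩
    y               ∎

  *-cancelˡ : ∀ {z x y} → z ≉ 0# → z * x ≈ z * y → x ≈ y
  *-cancelˡ {z} {x} {y} z≉0 zx≈zy =
    *-cancelʳ z≉0 (trans (*-comm x z) (trans zx≈zy (*-comm z y)))

  x*y≉0 : ∀ {x y} → x ≉ 0# → y ≉ 0# → x * y ≉ 0#
  x*y≉0 {x} x≉0 y≉0 xy≈0 = y≉0 (*-cancelˡ x≉0 (trans xy≈0 (sym (zeroʳ x))))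

  x≉y⇒x-y≉0 : ∀ {x y} → x ≉ y → x - y ≉ 0#
  x≉y⇒x-y≉0 {x} {y} x≉y x-y≈0 = x≉y (x∙y⁻¹≈ε⇒x≈y x y x-y≈0)

  xz/yz≈x/y : ∀ x {y z} → y ≉ 0# → z ≉ 0# → (x * z) / (y * z) ≈ x / y
  xz/yz≈x/y x {y} {z} y≉0 z≉0 = *-cancelʳ (x*y≉0 y≉0 z≉0) (begin
    ((x * z) / (y * z)) * (y * z)  ≈⟨ x/y*y≈x (x * z) (x*y≉0 y≉0 z≉0) ⟩
    x * z                          ≈⟨ *-congʳ (x/y*y≈x x y≉0) ⟨
    ((x / y) * y) * z              ≈⟨ *-assoc (x / y) y z ⟩
    (x / y) * (y * z)              ∎)

  ^-≉0 : ∀ {x} → x ≉ 0# → ∀ n → x ^ n ≉ 0#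
  ^-≉0 x≉0 zero    1≈0 = 0≉1 (sym 1≈0)
  ^-≉0 x≉0 (suc n)     = x*y≉0 x≉0 (^-≉0 x≉0 n)

  ^-distribˡ-+-* : ∀ x m n → x ^ (m ℕ.+ n) ≈ x ^ m * x ^ n
  ^-distribˡ-+-* x zero    n = sym (*-identityˡ (x ^ n))
  ^-distribˡ-+-* x (suc m) n = begin
    x * x ^ (m ℕ.+ n)      ≈⟨ *-congˡ (^-distribˡ-+-* x m n) ⟩
    x * (x ^ m * x ^ n)    ≈⟨ *-assoc x (x ^ m) (x ^ n) ⟨
    (x * x ^ m) * x ^ n    ∎

  ^-injective : ∀ {x} → x ≉ 0# → (∀ N → x ^ suc N ≉ 1#) →
                ∀ {m n} → x ^ m ≈ x ^ n → m ≡ n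
  ^-injective x≉0 xᴺ≉1 {zero}  {zero}  _   = ≡.refl
  ^-injective x≉0 xᴺ≉1 {zero}  {suc n} eq  = contradiction (sym eq) (xᴺ≉1 n)
  ^-injective x≉0 xᴺ≉1 {suc m} {zero}  eq  = contradiction eq (xᴺ≉1 m)
  ^-injective x≉0 xᴺ≉1 {suc m} {suc n} eq  =
    ≡.cong suc (^-injective x≉0 xᴺ≉1 (*-cancelˡ x≉0 eq))

module QIntegralProperties {c ℓ : Level} (F : Field c ℓ) (q : Field.Carrier F) where
  open Field F hiding (zero)
  open QIntegral F q
  open FieldProperties F
  open SetoidReasoning setoid
  open CommutativeSemigroupProperties +-commutativeSemigroup using (interchange; x∙yz≈y∙xz)
  open CommutativeSemigroupProperties *-commutativeSemigroup using (xy∙z≈xz∙y)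
  open RingProperties ring using (-0#≈0#; [y-z]x≈yx-zx)

  ⊴-witness-unique : q ≉ 0# → (∀ N → q ^ suc N ≉ 1#) → ∀ {x y} → y ≉ 0# →
                     (p p′ : x ⊴ y) → proj₁ p ≡ proj₁ p′
  ⊴-witness-unique q≉0 qᴺ≉1 y≉0 (m , x≈yqᵐ) (n , x≈yqⁿ) =
    ^-injective q≉0 qᴺ≉1 (*-cancelˡ y≉0 (trans (sym x≈yqᵐ) x≈yqⁿ))

  Iq-witness-irrelevant : q ≉ 0# → (∀ N → q ^ suc N ≉ 1#) → ∀ {x y} → y ≉ 0# →
                          ∀ us (p p′ : x ⊴ y) → Iq x us y p ≡ Iq x us y p′
  Iq-witness-irrelevant q≉0 qᴺ≉1 y≉0 us p p′ =
    ≡.cong (λ N → chainSum _ N us) (⊴-witness-unique q≉0 qᴺ≉1 y≉0 p p′)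

  ⊴-pow : ∀ {x y N n} → x ≈ y * q ^ N → n ≤ N → x ⊴ (y * q ^ n)
  ⊴-pow {x} {y} {N} {n} x≈yqᴺ n≤N = N ∸ n , (begin
    x                            ≈⟨ x≈yqᴺ ⟩
    y * q ^ N                    ≡⟨ ≡.cong (λ k → y * q ^ k) (m+[n∸m]≡n n≤N) ⟨
    y * q ^ (n ℕ.+ (N ∸ n))      ≈⟨ *-congˡ (^-distribˡ-+-* q n (N ∸ n)) ⟩
    y * (q ^ n * q ^ (N ∸ n))    ≈⟨ *-assoc y (q ^ n) (q ^ (N ∸ n)) ⟨
    y * q ^ n * q ^ (N ∸ n)      ∎)

  sumTo-cong : ∀ B {f g : ℕ → Carrier} → (∀ n → n ≤ B → f n ≈ g n) →
               sumTo B f ≈ sumTo B g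
  sumTo-cong zero    f≈g = f≈g zero ≤-refl
  sumTo-cong (suc B) f≈g =
    +-cong (sumTo-cong B (λ n n≤B → f≈g n (m≤n⇒m≤1+n n≤B))) (f≈g (suc B) ≤-refl)

  sumTo-shift : ∀ M (f : ℕ → Carrier) →
                sumTo (suc M) f ≈ f 0 + sumTo M (λ n → f (suc n))
  sumTo-shift zero    f = refl
  sumTo-shift (suc M) f = trans (+-congʳ (sumTo-shift M f)) (+-assoc _ _ _)

  sumTo-distrib-+ : ∀ B (f g : ℕ → Carrier) →
                    sumTo B (λ n → f n + g n) ≈ sumTo B f + sumTo B g
  sumTo-distrib-+ zero    f g = refl
  sumTo-distrib-+ (suc B) f g =
    trans (+-congʳ (sumTo-distrib-+ B f g)) (interchange _ _ _ _)

  factor : Carrier → Carrier → ℕ → Carrier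
  factor y u n = (y * q ^ n) / (y * q ^ n - u)

  factor-0#*x≈x : q ≉ 0# → ∀ {y} → y ≉ 0# → ∀ n x → factor y 0# n * x ≈ x
  factor-0#*x≈x q≉0 {y} y≉0 n x = begin
    (t / (t - 0#)) * x  ≈⟨ *-congʳ (/-cong refl t-0≈t) ⟩
    (t / t) * x         ≈⟨ *-congʳ (inverseʳ t (x*y≉0 y≉0 (^-≉0 q≉0 n))) ⟩
    1# * x              ≈⟨ *-identityˡ x ⟩
    x                   ∎
    where
    t : Carrier
    t = y * q ^ n
    t-0≈t : t - 0# ≈ t
    t-0≈t = trans (+-congˡ -0#≈0#) (+-identityʳ t)

  factor-*q : ∀ y u n → factor (y * q) u n ≈ factor y u (suc n)
  factor-*q y u n = /-cong yq·qⁿ≈y·qⁿ⁺¹ (+-congʳ yq·qⁿ≈y·qⁿ⁺¹)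
    where
    yq·qⁿ≈y·qⁿ⁺¹ : y * q * q ^ n ≈ y * q ^ suc n
    yq·qⁿ≈y·qⁿ⁺¹ = *-assoc y q (q ^ n)

  factor-scale : q ≉ 0# → ∀ {y u n} → y * q ^ n ≉ u →
                 factor (y * q) (u * q) n ≈ factor y u n
  factor-scale q≉0 {y} {u} {n} t≉u = begin
    (y * q * q ^ n) / (y * q * q ^ n - u * q)  ≈⟨ /-cong yq·qⁿ≈tq (+-congʳ yq·qⁿ≈tq) ⟩
    (t * q) / (t * q - u * q)                  ≈⟨ /-cong refl ([y-z]x≈yx-zx q t u) ⟨
    (t * q) / ((t - u) * q)                    ≈⟨ xz/yz≈x/y t (x≉y⇒x-y≉0 t≉u) q≉0 ⟩
    t / (t - u)                                ∎
    where
    t : Carrier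
    t = y * q ^ n
    yq·qⁿ≈tq : y * q * q ^ n ≈ t * q
    yq·qⁿ≈tq = xy∙z≈xz∙y y q (q ^ n)

  Avoids : Carrier → ℕ → List Carrier → Set (c ⊔ ℓ)
  Avoids y B us = ∀ n → n ≤ B → All (λ u → y * q ^ n ≉ u) us

  Avoids-mono : ∀ {y k B us} → k ≤ B → Avoids y B us → Avoids y k us
  Avoids-mono k≤B avoid n n≤k = avoid n (≤-trans n≤k k≤B)

  chainSum-scale : q ≉ 0# → ∀ {y} B us → Avoids y B us →
                   chainSum (y * q) B (map (_* q) us) ≈ chainSum y B us
  chainSum-scale q≉0 B []       _     = refl
  chainSum-scale q≉0 B (u ∷ us) avoid = sumTo-cong B λ n n≤B →
    *-cong (factor-scale q≉0 {n = n} (All.head (avoid n n≤B)))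
           (chainSum-scale q≉0 n us (λ m m≤n → All.tail (avoid m (≤-trans m≤n n≤B))))

  chainSum-zero-insert-0# : q ≉ 0# → ∀ {y} → y ≉ 0# → ∀ bs cs →
                            chainSum y 0 (bs ++ 0# ∷ cs) ≈ chainSum y 0 (bs ++ cs)
  chainSum-zero-insert-0# q≉0 y≉0 []       cs = factor-0#*x≈x q≉0 y≉0 0 _
  chainSum-zero-insert-0# q≉0 y≉0 (b ∷ bs) cs =
    *-congˡ (chainSum-zero-insert-0# q≉0 y≉0 bs cs)

  chainSum-insert-0# : q ≉ 0# → ∀ {y} → y ≉ 0# → ∀ bs cs M → Avoids y M cs →
    chainSum y (suc M) (bs ++ 0# ∷ cs)
      ≈ chainSum (y * q) M (bs ++ 0# ∷ map (_* q) cs) + chainSum y (suc M) (bs ++ cs)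
  chainSum-insert-0# q≉0 {y} y≉0 [] cs M avoid =
    +-cong (sumTo-cong M lower-terms) (factor-0#*x≈x q≉0 y≉0 (suc M) _)
    where
    lower-terms : ∀ n → n ≤ M → factor y 0# n * chainSum y n cs
                          ≈ factor (y * q) 0# n * chainSum (y * q) n (map (_* q) cs)
    lower-terms n n≤M = begin
      factor y 0# n * chainSum y n cs
        ≈⟨ factor-0#*x≈x q≉0 y≉0 n _ ⟩
      chainSum y n cs
        ≈⟨ chainSum-scale q≉0 n cs (Avoids-mono n≤M avoid) ⟨
      chainSum (y * q) n (map (_* q) cs)
        ≈⟨ factor-0#*x≈x q≉0 (x*y≉0 y≉0 q≉0) n _ ⟨
      factor (y * q) 0# n * chainSum (y * q) n (map (_* q) cs) ∎
  chainSum-insert-0# q≉0 {y} y≉0 (b ∷ bs) cs M avoid = begin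
    sumTo (suc M) (λ n → f n * A n)
      ≈⟨ sumTo-shift M _ ⟩
    f 0 * A 0 + sumTo M (λ n → f (suc n) * A (suc n))
      ≈⟨ +-cong (*-congˡ (chainSum-zero-insert-0# q≉0 y≉0 bs cs)) (sumTo-cong M split) ⟩
    f 0 * C 0 + sumTo M (λ n → g n * B n + f (suc n) * C (suc n))
      ≈⟨ +-congˡ (sumTo-distrib-+ M _ _) ⟩
    f 0 * C 0 + (sumTo M (λ n → g n * B n) + tail-C)
      ≈⟨ x∙yz≈y∙xz _ _ _ ⟩
    sumTo M (λ n → g n * B n) + (f 0 * C 0 + tail-C)
      ≈⟨ +-congˡ (sumTo-shift M _) ⟨
    sumTo M (λ n → g n * B n) + sumTo (suc M) (λ n → f n * C n) ∎
    where
    f g A B C : ℕ → Carrier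
    f = factor y b
    g = factor (y * q) b
    A n = chainSum y n (bs ++ 0# ∷ cs)
    B n = chainSum (y * q) n (bs ++ 0# ∷ map (_* q) cs)
    C n = chainSum y n (bs ++ cs)

    tail-C : Carrier
    tail-C = sumTo M (λ n → f (suc n) * C (suc n))

    split : ∀ n → n ≤ M → f (suc n) * A (suc n) ≈ g n * B n + f (suc n) * C (suc n)
    split n n≤M = begin
      f (suc n) * A (suc n)
        ≈⟨ *-congˡ (chainSum-insert-0# q≉0 y≉0 bs cs n (Avoids-mono n≤M avoid)) ⟩
      f (suc n) * (B n + C (suc n))
        ≈⟨ distribˡ (f (suc n)) (B n) (C (suc n)) ⟩
      f (suc n) * B n + f (suc n) * C (suc n)
        ≈⟨ +-congʳ (*-congʳ (factor-*q y b n)) ⟨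
      g n * B n + f (suc n) * C (suc n) ∎

corollary2p5 : {c ℓ : Level} (F : Field c ℓ) →
    let open Field F in
    let open QIntegral F in
    (q : Carrier) → q ≉ 0# → (∀ (N : ℕ) → q ^ suc N ≉ 1#) →
    (a₀ aₖ₊₁ : Carrier) → a₀ ≉ 0# → aₖ₊₁ ≉ 0# →
    (bs cs : List Carrier) →
    (d₁ : IqDefined q a₀ (bs ++ (0# ∷ cs)) aₖ₊₁) →
    (d₂ : IqDefined q a₀ (bs ++ (0# ∷ map (λ a → a * q) cs)) (aₖ₊₁ * q)) →
    (d₃ : IqDefined q a₀ (bs ++ cs) aₖ₊₁) →
    Iq q a₀ (bs ++ (0# ∷ cs)) aₖ₊₁ (proj₁ d₁)
      - Iq q a₀ (bs ++ (0# ∷ map (λ a → a * q) cs)) (aₖ₊₁ * q) (proj₁ d₂)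
      ≈ Iq q a₀ (bs ++ cs) aₖ₊₁ (proj₁ d₃)
-- a₀ ≉ 0# and the chain conditions of d₂ and d₃ follow from d₁.
corollary2p5 F q q≉0 qᴺ≉1 a₀ a _ a≉0 bs cs (p₁ , avoids) ((M , a₀≈aq·qᴹ) , _) (p₃ , _) = begin
  Iq a₀ (bs ++ 0# ∷ cs) a p₁ - S   ≡⟨ ≡.cong (_- S) (irrelevant (bs ++ 0# ∷ cs) p₁ p) ⟩
  Iq a₀ (bs ++ 0# ∷ cs) a p - S    ≈⟨ +-congʳ (chainSum-insert-0# q≉0 a≉0 bs cs M cs-avoided) ⟩
  (S + Iq a₀ (bs ++ cs) a p) - S   ≈⟨ xyx⁻¹≈y S _ ⟩
  Iq a₀ (bs ++ cs) a p             ≡⟨ irrelevant (bs ++ cs) p p₃ ⟩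
  Iq a₀ (bs ++ cs) a p₃            ∎
  where
  open Field F hiding (zero)
  open QIntegral F q
  open QIntegralProperties F q
  open SetoidReasoning setoid
  open AbelianGroupProperties +-abelianGroup using (xyx⁻¹≈y)

  irrelevant : ∀ us (p p′ : a₀ ⊴ a) → Iq a₀ us a p ≡ Iq a₀ us a p′
  irrelevant = Iq-witness-irrelevant q≉0 qᴺ≉1 a≉0

  S : Carrier
  S = Iq a₀ (bs ++ 0# ∷ map (_* q) cs) (a * q) (M , a₀≈aq·qᴹ)

  a₀≈aqᴹ⁺¹ : a₀ ≈ a * q ^ suc M
  a₀≈aqᴹ⁺¹ = trans a₀≈aq·qᴹ (*-assoc a q (q ^ M))

  p : a₀ ⊴ a
  p = suc M , a₀≈aqᴹ⁺¹

  cs-avoided : Avoids a M cs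
  cs-avoided n n≤M =
    All.tail (++⁻ʳ bs (avoids (a * q ^ n) (⊴-pow a₀≈aqᴹ⁺¹ (m≤n⇒m≤1+n n≤M)) (n , refl)))
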